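{- There is a non-monotone submodular function that is not weakly submodular. More specifically, there is a finite graph $G=(V,E)$ whose cut function $f(S)=|\{\{x,y\}\in E: |\{x,y\}\cap S|=1\}|$ (for $S\subseteq V$) is not weakly submodular, i.e. there exist $S,T\subseteq V$ with $|T|f(S)+|S|f(T)< |S\cap T|\,f(S\cup T)+|S\cup T|\,f(S\cap T)$.
   Context: A normalized ($f(\emptyset)=0$), non-negative set function $f$ on a finite universe $U$ is called weakly submodular if for all $S,T\subseteq U$: $|T|f(S)+|S|f(T)\ge |S\cap T|\,f(S\cup T)+|S\cup T|\,f(S\cap T)$. A set function is submodular if $f(S)+f(T)\ge f(S\cup T)+f(S\cap T)$ for all $S,T$. -}

module Defs where

open import Data.Nat using (ℕ; _+_; _*_; _≤_; _<_)
open import Data.Bool using (Bool; true; false; _xor_; _∧_; if_then_else_)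
open import Data.Fin using (Fin; toℕ)
open import Data.Fin.Subset using (Subset; _∈_; _∉_; ⊥; _∩_; _∪_; _⊆_; ∣_∣)
open import Data.List using (List; length; filter; allFin; concatMap; map)
open import Data.Product using (_×_; _,_; Σ; ∃; ∃₂)
open import Data.Vec using (lookup)
open import Relation.Binary.PropositionalEquality using (_≡_)
open import Relation.Nullary using (¬_)
open import Relation.Nullary.Decidable using (⌊_⌋)
open import Data.Nat.Properties using (_<?_)

record Graph (n : ℕ) : Set where
  field
    adj   : Fin n → Fin n → Bool
    sym   : ∀ x y → adj x y ≡ adj y x
    irrefl : ∀ x → adj x x ≡ false
open Graph public

-- All unordered pairs {x,y} with x ≠ y, represented as (x , y) with toℕ x < toℕ y.
pairs : (n : ℕ) → List (Fin n × Fin n)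
pairs n = filter (λ p → Data.Nat.Properties._<?_ (toℕ (Data.Product.proj₁ p)) (toℕ (Data.Product.proj₂ p)))
                 (concatMap (λ x → map (λ y → (x , y)) (allFin n)) (allFin n))
  where import Data.Product

edges : {n : ℕ} → Graph n → List (Fin n × Fin n)
edges {n} G = filter (λ p → Data.Bool._≟_ (adj G (Data.Product.proj₁ p) (Data.Product.proj₂ p)) true) (pairs n)
  where import Data.Product
        import Data.Bool

cut : {n : ℕ} → Graph n → Subset n → ℕ
cut G S = length (filter (λ p → Data.Bool._≟_ (lookup S (Data.Product.proj₁ p) xor lookup S (Data.Product.proj₂ p)) true) (edges G))
  where import Data.Product
        import Data.Bool

Normalized : {n : ℕ} → (Subset n → ℕ) → Set
Normalized f = f ⊥ ≡ 0

Submodular : {n : ℕ} → (Subset n → ℕ) → Set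
Submodular {n} f = ∀ (S T : Subset n) → f (S ∪ T) + f (S ∩ T) ≤ f S + f T

Monotone : {n : ℕ} → (Subset n → ℕ) → Set
Monotone {n} f = ∀ (S T : Subset n) → S ⊆ T → f S ≤ f T

WeaklySubmodular : {n : ℕ} → (Subset n → ℕ) → Set
WeaklySubmodular {n} f = ∀ (S T : Subset n) →
  ∣ S ∩ T ∣ * f (S ∪ T) + ∣ S ∪ T ∣ * f (S ∩ T) ≤ ∣ T ∣ * f S + ∣ S ∣ * f T

-- A cut function is a sum, over the edges, of the cut function of a single
-- edge, and the latter is submodular by a truth table; hence every cut function
-- is submodular and vanishes on ∅.  Weak submodularity fails for the
-- graph on {0,1,2} with the single edge {0,1}: for S = {0,1}, T = {0,2} the left
-- side |T| f(S) + |S| f(T) is 3·0 + 2·1 = 2, while |S ∩ T| f(S ∪ T) + |S ∪ T| f(S ∩ T)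
-- is 1·0 + 3·1 = 3, because the full set cuts nothing but {0} cuts the edge.
module Submission where

open import Defs hiding (sym)
open import Data.Nat using (ℕ; _+_; _*_; _<_; _≤_; z≤n; s≤s)
open import Data.Nat.Properties using (+-mono-≤; ≤ᵇ⇒≤; <⇒≱; +-commutativeSemigroup)
open import Algebra.Properties.CommutativeSemigroup +-commutativeSemigroup using (interchange)
open import Data.Bool using (Bool; true; false; _∧_; _∨_; _xor_)
open import Data.Bool.Properties using () renaming (_≟_ to _≟ᵇ_)
open import Data.Fin using (Fin; zero; suc)
open import Data.Fin.Subset using (Subset; ⊥; ⊤; _∩_; _∪_; ∣_∣)
open import Data.Fin.Subset.Properties using (∈⊤)
open import Data.List using (List; []; _∷_; length; filter)
open import Data.Product using (Σ; _×_; ∃₂; _,_; proj₁; proj₂)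
open import Data.Vec using (_∷_; []; lookup)
open import Data.Vec.Properties using (lookup-zipWith; lookup-replicate)
open import Relation.Binary.PropositionalEquality using (_≡_; refl; sym; cong₂; subst₂)
open import Relation.Nullary using (¬_)

private
  variable
    n : ℕ

χ : Bool → ℕ
χ true  = 1
χ false = 0

xor-submodular : ∀ a b c d →
  χ ((a ∨ c) xor (b ∨ d)) + χ ((a ∧ c) xor (b ∧ d)) ≤ χ (a xor b) + χ (c xor d)
xor-submodular false false false false = z≤n
xor-submodular false false false true  = ≤ᵇ⇒≤ _ _ _
xor-submodular false false true  false = ≤ᵇ⇒≤ _ _ _
xor-submodular false false true  true  = z≤n
xor-submodular false true  false false = ≤ᵇ⇒≤ _ _ _
xor-submodular false true  false true  = ≤ᵇ⇒≤ _ _ _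
xor-submodular false true  true  false = ≤ᵇ⇒≤ _ _ _
xor-submodular false true  true  true  = ≤ᵇ⇒≤ _ _ _
xor-submodular true  false false false = ≤ᵇ⇒≤ _ _ _
xor-submodular true  false false true  = ≤ᵇ⇒≤ _ _ _
xor-submodular true  false true  false = ≤ᵇ⇒≤ _ _ _
xor-submodular true  false true  true  = ≤ᵇ⇒≤ _ _ _
xor-submodular true  true  false false = z≤n
xor-submodular true  true  false true  = ≤ᵇ⇒≤ _ _ _
xor-submodular true  true  true  false = ≤ᵇ⇒≤ _ _ _
xor-submodular true  true  true  true  = z≤n

crosses : Subset n → Fin n × Fin n → Bool
crosses S e = lookup S (proj₁ e) xor lookup S (proj₂ e)

crossings : Subset n → List (Fin n × Fin n) → ℕ
crossings S es = length (filter (λ e → crosses S e ≟ᵇ true) es)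

crossings-∷ : ∀ (S : Subset n) e es → crossings S (e ∷ es) ≡ χ (crosses S e) + crossings S es
crossings-∷ S e es with crosses S e
... | true  = refl
... | false = refl

crosses-∪ : ∀ (S T : Subset n) e →
  crosses (S ∪ T) e ≡ (lookup S (proj₁ e) ∨ lookup T (proj₁ e)) xor (lookup S (proj₂ e) ∨ lookup T (proj₂ e))
crosses-∪ S T (x , y) = cong₂ _xor_ (lookup-zipWith _∨_ x S T) (lookup-zipWith _∨_ y S T)

crosses-∩ : ∀ (S T : Subset n) e →
  crosses (S ∩ T) e ≡ (lookup S (proj₁ e) ∧ lookup T (proj₁ e)) xor (lookup S (proj₂ e) ∧ lookup T (proj₂ e))
crosses-∩ S T (x , y) = cong₂ _xor_ (lookup-zipWith _∧_ x S T) (lookup-zipWith _∧_ y S T)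

crosses-submodular : ∀ (S T : Subset n) e →
  χ (crosses (S ∪ T) e) + χ (crosses (S ∩ T) e) ≤ χ (crosses S e) + χ (crosses T e)
crosses-submodular S T e@(x , y) =
  subst₂ (λ u v → χ u + χ v ≤ χ (crosses S e) + χ (crosses T e)) (sym (crosses-∪ S T e)) (sym (crosses-∩ S T e))
    (xor-submodular (lookup S x) (lookup S y) (lookup T x) (lookup T y))

crossings-submodular : ∀ (S T : Subset n) es →
  crossings (S ∪ T) es + crossings (S ∩ T) es ≤ crossings S es + crossings T es
crossings-submodular S T []       = z≤n
crossings-submodular S T (e ∷ es)
  rewrite crossings-∷ (S ∪ T) e es | crossings-∷ (S ∩ T) e es
        | crossings-∷ S e es | crossings-∷ T e es
        | interchange (χ (crosses (S ∪ T) e)) (crossings (S ∪ T) es) (χ (crosses (S ∩ T) e)) (crossings (S ∩ T) es)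
        | interchange (χ (crosses S e)) (crossings S es) (χ (crosses T e)) (crossings T es)
  = +-mono-≤ (crosses-submodular S T e) (crossings-submodular S T es)

crossings-⊥ : ∀ (es : List (Fin n × Fin n)) → crossings ⊥ es ≡ 0
crossings-⊥ []            = refl
crossings-⊥ ((x , y) ∷ es)
  rewrite lookup-replicate x false | lookup-replicate y false = crossings-⊥ es

cut-normalized : (G : Graph n) → Normalized (cut G)
cut-normalized G = crossings-⊥ (edges G)

cut-submodular : (G : Graph n) → Submodular (cut G)
cut-submodular G S T = crossings-submodular S T (edges G)

single-edge-adj : Fin 3 → Fin 3 → Bool
single-edge-adj zero       (suc zero) = true
single-edge-adj (suc zero) zero       = true
single-edge-adj _          _          = false

single-edge : Graph 3
single-edge = record { adj = single-edge-adj ; sym = symmetric ; irrefl = irreflexive }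
  where
    symmetric : ∀ x y → single-edge-adj x y ≡ single-edge-adj y x
    symmetric zero             zero             = refl
    symmetric zero             (suc zero)       = refl
    symmetric zero             (suc (suc zero)) = refl
    symmetric (suc zero)       zero             = refl
    symmetric (suc zero)       (suc zero)       = refl
    symmetric (suc zero)       (suc (suc zero)) = refl
    symmetric (suc (suc zero)) zero             = refl
    symmetric (suc (suc zero)) (suc zero)       = refl
    symmetric (suc (suc zero)) (suc (suc zero)) = refl

    irreflexive : ∀ x → single-edge-adj x x ≡ false
    irreflexive zero             = refl
    irreflexive (suc zero)       = refl
    irreflexive (suc (suc zero)) = refl

S₀ T₀ : Subset 3
S₀ = true ∷ true  ∷ false ∷ []
T₀ = true ∷ false ∷ true  ∷ []

single-edge-violation :
  ∣ T₀ ∣ * cut single-edge S₀ + ∣ S₀ ∣ * cut single-edge T₀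
    < ∣ S₀ ∩ T₀ ∣ * cut single-edge (S₀ ∪ T₀) + ∣ S₀ ∪ T₀ ∣ * cut single-edge (S₀ ∩ T₀)
single-edge-violation = ≤ᵇ⇒≤ 3 3 _

single-edge-not-monotone : ¬ Monotone (cut single-edge)
single-edge-not-monotone monotone with monotone (true ∷ false ∷ false ∷ []) ⊤ (λ _ → ∈⊤)
... | ()

single-edge-not-weakly-submodular : ¬ WeaklySubmodular (cut single-edge)
single-edge-not-weakly-submodular weakly = <⇒≱ single-edge-violation (weakly S₀ T₀)

proposition2 : Σ ℕ (λ n → Σ (Graph n) (λ G →
    Normalized (cut G) × Submodular (cut G) × ¬ Monotone (cut G) × ¬ WeaklySubmodular (cut G)
    × ∃₂ (λ (S T : Subset n) →
    ∣ T ∣ * cut G S + ∣ S ∣ * cut G T < ∣ S ∩ T ∣ * cut G (S ∪ T) + ∣ S ∪ T ∣ * cut G (S ∩ T))))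
proposition2 =
  3 , single-edge
    , cut-normalized single-edge
    , cut-submodular single-edge
    , single-edge-not-monotone
    , single-edge-not-weakly-submodular
    , S₀ , T₀ , single-edge-violation
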